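{- Assume there exists a deterministic broadcast protocol $\pi_0$ that completes broadcast in at most $r$ rounds on every $C_2$ network. Then there exists a deterministic broadcast protocol $\pi_1$ that completes broadcast in at most $3r$ rounds on every $C_2$ network, and such that nodes in layer $L_i$ transmit in round $t$ only if $t\equiv i \pmod 3$, for $i=0,1,2$.
   Context: Radio network model: undirected connected graph of processors with distinct labels from $\{0,\dots,m\}$ ($m$ polynomial in the number of nodes); label $0$ is the source, which holds a broadcast message. Synchronous rounds $0,1,\dots$; all nodes run identical copies of the same deterministic protocol; in each round each node transmits, receives or is inactive. A node receives a message iff it is a receiver and exactly one neighbour transmits; otherwise it receives $\phi$. Messages are authenticated (receiver learns sender's label). A node's action is determined by its own label, its neighbours' labels and its previously received messages. In round $0$ only the source transmits; only nodes that have received a message may transmit. Broadcast completes in $r$ rounds if all nodes receive the source message in rounds $0,\dots,r-1$. $C_2$ networks: layer $L_0$ is the source; $L_1$ consists of $\sqrt{n}$ groups of $\sqrt{n}$ nodes each, all adjacent to the source; $L_2$ consists of $\sqrt{n}$ nodes, the $i$-th adjacent to an arbitrary subset of the $i$-th group (no other edges). Labels are fixed across all $C_2$ networks. -}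

module Defs where

open import Data.Nat using (ℕ; zero; suc; _≡ᵇ_; _<_)
open import Data.Bool using (Bool; true; false; _∧_; if_then_else_)
open import Data.Fin using (Fin; _≟_)
open import Data.List using (List; []; _∷_; _++_; map; concatMap; mapMaybe)
open import Data.Bool.ListAction using (any)
open import Data.List using () renaming (allFin to allFinL)
open import Data.Vec using (Vec; []; _∷_)
open import Data.Vec.Relation.Unary.All using (All)
open import Data.Maybe using (Maybe; just; nothing; Is-just)
open import Data.Product using (_×_; _,_; ∃; ∃-syntax)
open import Data.Empty using (⊥)
open import Relation.Nullary using (¬_; does)
open import Relation.Binary.PropositionalEquality using (_≡_; _≢_)

-- What a node does in a round.  A transmitted message carries the
-- source message together with an arbitrary extra payload (a natural
-- number, which can encode any finite amount of information).
data Action : Set where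
  transmit : ℕ → Action
  receive  : Action
  inactive : Action

IsTransmit : Action → Set
IsTransmit a = ∃[ p ] (a ≡ transmit p)

-- What a node hears in a round: φ (= nothing) or (sender label , payload)
-- (messages are authenticated).
Heard : Set
Heard = Maybe (ℕ × ℕ)

-- History of a node before round t: what it heard in rounds 0..t-1,
-- newest first.
History : ℕ → Set
History t = Vec Heard t

-- A deterministic protocol: the action in round t is a function of the
-- node's own label, the set of its neighbours' labels (as a
-- characteristic function) and its history of received messages.
ProtocolFn : Set
ProtocolFn = (t : ℕ) → (ownLabel : ℕ) → (nbrLabels : ℕ → Bool) → History t → Action

-- Model rule: only the source (label 0) and nodes that already received
-- a message may transmit (in particular only the source in round 0).
record Protocol : Set where
  field
    act   : ProtocolFn
    valid : ∀ t ℓ (nb : ℕ → Bool) (h : History t) → ℓ ≢ 0 →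
            All (λ x → x ≡ nothing) h → ¬ IsTransmit (act t ℓ nb h)
open Protocol public

record Network : Set₁ where
  field
    V     : Set
    nodes : List V
    adj   : V → V → Bool
    label : V → ℕ
    src   : V
open Network public

txOf : Action → ℕ → Maybe (ℕ × ℕ)
txOf (transmit p) ℓ = just (ℓ , p)
txOf receive      ℓ = nothing
txOf inactive     ℓ = nothing

deliver : Action → List (ℕ × ℕ) → Heard
deliver receive (x ∷ []) = just x
deliver _       _        = nothing

module Execution (N : Network) (π : Protocol) where

  nbrLabels : V N → ℕ → Bool
  nbrLabels v ℓ = any (λ u → adj N v u ∧ (label N u ≡ᵇ ℓ)) (nodes N)

  actWith : (t : ℕ) → (V N → History t) → V N → Action
  actWith t h u = act π t (label N u) (nbrLabels u) (h u)

  stepWith : (t : ℕ) → (V N → History t) → V N → Heard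
  stepWith t h v =
    deliver (actWith t h v)
            (mapMaybe (λ u → if adj N v u then txOf (actWith t h u) (label N u) else nothing)
                      (nodes N))

  hist : (t : ℕ) → V N → History t
  hist zero    v = []
  hist (suc t) v = stepWith t (hist t) v ∷ hist t v

  actionAt : ℕ → V N → Action
  actionAt t v = actWith t (hist t) v

  heardAt : ℕ → V N → Heard
  heardAt t v = stepWith t (hist t) v

Completes : (N : Network) → Protocol → ℕ → Set
Completes N π r = ∀ (v : V N) → v ≢ src N →
  ∃[ t ] (t < r × Is-just (Execution.heardAt N π t v))

-- C₂ networks with n = s², √n = s

data C2Node (s : ℕ) : Set where
  source : C2Node s
  l1     : Fin s → Fin s → C2Node s   -- l1 i j : j-th node of group i in L₁
  l2     : Fin s → C2Node s

layer : ∀ {s} → C2Node s → ℕ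
layer source   = 0
layer (l1 _ _) = 1
layer (l2 _)   = 2

c2nodes : (s : ℕ) → List (C2Node s)
c2nodes s = source ∷ (concatMap (λ i → map (l1 i) (allFinL s)) (allFinL s)
                      ++ map l2 (allFinL s))

-- S i j = true iff node j of group i is adjacent to the i-th L₂ node
c2adj : ∀ {s} → (Fin s → Fin s → Bool) → C2Node s → C2Node s → Bool
c2adj S source   (l1 _ _) = true
c2adj S (l1 _ _) source   = true
c2adj S (l1 i j) (l2 k)   = S i j ∧ does (i ≟ k)
c2adj S (l2 k)   (l1 i j) = S i j ∧ does (i ≟ k)
c2adj S _        _        = false

C2Connected : ∀ {s} → (Fin s → Fin s → Bool) → Set
C2Connected {s} S = ∀ (i : Fin s) → ∃[ j ] (S i j ≡ true)

C2net : (s : ℕ) → (C2Node s → ℕ) → (Fin s → Fin s → Bool) → Network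
C2net s lab S = record
  { V = C2Node s ; nodes = c2nodes s ; adj = c2adj S ; label = lab ; src = source }

module Submission where

-- Layered broadcast on C₂ networks.  π₁ slows π₀ down by a factor 3:
-- round t of π₀ becomes the phase of sub-rounds 3t, 3t+1, 3t+2, and in
-- sub-round 3t+i only layer-Lᵢ nodes may transmit (doing exactly what π₀
-- prescribes in round t); all other nodes listen.  A node can tell its
-- layer locally (label 0 is the source, a neighbour labelled 0 means L₁,
-- otherwise L₂), and it can recover what it would have heard in round t of
-- π₀: source and L₂ nodes only have L₁ neighbours, who all speak in
-- sub-round 3t+1; an L₁ node has exactly two potential senders, the source
-- (sub-round 3t) and its L₂ node (sub-round 3t+2), and hears under π₀ iff
-- exactly one of them transmits.

open import Defs
open import Data.Nat using (ℕ; _*_; _%_)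
open import Data.Bool using (Bool)
open import Data.Fin using (Fin)
open import Data.Product using (Σ; _×_)
open import Function.Definitions using (Injective)
open import Relation.Binary.PropositionalEquality using (_≡_)

open import Data.Nat using (zero; suc; _+_; _/_; _≡ᵇ_; _<_; s≤s; z≤n)
open import Data.Nat.Properties
  using (≡ᵇ⇒≡; ≡⇒≡ᵇ; m<1+n⇒m<n∨m≡n; m≤n+m; +-monoˡ-<; *-monoˡ-≤; *-comm; ≤-trans)
open import Data.Nat.DivMod using ([m+kn]%n≡m%n; m<n⇒m%n≡m; +-distrib-/-∣ʳ; m<n⇒m/n≡0; m*n/n≡m)
open import Data.Nat.Divisibility using (n∣m*n)
open import Data.Bool using (true; false; if_then_else_; _∧_; _∨_; T)
open import Data.Bool.Properties using (∧-zeroʳ; if-eta)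
open import Data.Bool.ListAction using (any)
open import Data.Maybe using (Maybe; just; nothing; Is-just)
open import Data.List using (List; []; _∷_; _++_; map; mapMaybe; concatMap; tabulate; fromMaybe; allFin)
open import Data.List.Properties using (mapMaybe-cong; mapMaybe-map; mapMaybe-++; ++-identityʳ)
open import Data.Vec using ([]; _∷_)
open import Data.Vec.Relation.Unary.All using (All; []; _∷_)
open import Data.Product using (_,_; proj₁; proj₂)
open import Data.Sum using (_⊎_; inj₁; inj₂)
open import Data.Empty using (⊥-elim)
open import Data.Unit using (tt)
open import Relation.Nullary using (¬_; does)
open import Relation.Nullary.Decidable using (dec-false)
open import Relation.Binary.PropositionalEquality
  using (refl; sym; trans; cong; cong₂; subst; _≢_; module ≡-Reasoning)
open import Data.Fin using (_≟_) renaming (zero to fzero; suc to fsuc)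
open import Data.Fin.Properties using (suc-injective)
open import Function using (_∘_)

listening : Action → Action
listening (transmit p) = transmit p
listening receive      = receive
listening inactive     = receive

txOf-listening : ∀ a ℓ → txOf (listening a) ℓ ≡ txOf a ℓ
txOf-listening (transmit p) ℓ = refl
txOf-listening receive      ℓ = refl
txOf-listening inactive     ℓ = refl

transmitIf : Bool → Action → Action
transmitIf b a = if b then listening a else receive

transmitIf-transmits : ∀ b a → IsTransmit (transmitIf b a) → T b × IsTransmit a
transmitIf-transmits true  (transmit q) _       = tt , (q , refl)
transmitIf-transmits true  receive      (_ , ())
transmitIf-transmits true  inactive     (_ , ())
transmitIf-transmits false a            (_ , ())

heardAs : Action → Heard → Heard
heardAs receive      x = x
heardAs (transmit _) _ = nothing
heardAs inactive     _ = nothing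

deliver-heardAs : ∀ a L → deliver a L ≡ heardAs a (deliver receive L)
deliver-heardAs (transmit p) L = refl
deliver-heardAs receive      L = refl
deliver-heardAs inactive     L = refl

heardAs-silent : ∀ a → heardAs a nothing ≡ nothing
heardAs-silent (transmit _) = refl
heardAs-silent receive      = refl
heardAs-silent inactive     = refl

heardAs-just : ∀ a x → Is-just (heardAs a x) → Is-just x
heardAs-just receive x j = j

-- Reception from two potential senders heard separately: a message gets
-- through iff exactly one of them sends.
merge : Heard → Heard → Heard
merge (just x) nothing  = just x
merge (just _) (just _) = nothing
merge nothing  y        = y

merge-spec : ∀ P Q → merge P Q ≡ deliver receive (fromMaybe P ++ fromMaybe Q)
merge-spec (just x) (just y) = refl
merge-spec (just x) nothing  = refl
merge-spec nothing  (just y) = refl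
merge-spec nothing  nothing  = refl

merge-identityʳ : ∀ P → merge P nothing ≡ P
merge-identityʳ (just x) = refl
merge-identityʳ nothing  = refl

merge-just : ∀ x z → Is-just (merge x z) → Is-just x ⊎ Is-just z
merge-just (just x) nothing j = inj₁ j
merge-just nothing  z       j = inj₂ j

-- The value heard in round k according to a history of length n (newest
-- first); φ for rounds not yet played.
heardIn : ∀ {n} → History n → ℕ → Heard
heardIn []              k = nothing
heardIn {suc n} (x ∷ h) k = if k ≡ᵇ n then x else heardIn h k

heardIn-silent : ∀ {n} (h : History n) → All (λ x → x ≡ nothing) h → ∀ k → heardIn h k ≡ nothing
heardIn-silent []      []         k = refl
heardIn-silent {suc n} (x ∷ h) (x≡φ ∷ h≡φ) k with k ≡ᵇ n
... | true  = x≡φ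
... | false = heardIn-silent h h≡φ k

-- In any execution, the history of v records in position k what v heard in
-- round k.  This is how π₁ reads off the sub-rounds it needs.
heardIn-hist : ∀ N π n v k → k < n →
               heardIn (Execution.hist N π n v) k ≡ Execution.heardAt N π k v
heardIn-hist N π (suc n) v k k<1+n with k ≡ᵇ n in k≡ᵇn
... | true = cong (λ m → Execution.heardAt N π m v) (sym (≡ᵇ⇒≡ k n (subst T (sym k≡ᵇn) tt)))
... | false with m<1+n⇒m<n∨m≡n k<1+n
...   | inj₁ k<n  = heardIn-hist N π n v k k<n
...   | inj₂ refl = ⊥-elim (subst T k≡ᵇn (≡⇒≡ᵇ k k refl))

inferLayer : ℕ → (ℕ → Bool) → ℕ
inferLayer ℓ nb = if ℓ ≡ᵇ 0 then 0 else (if nb 0 then 1 else 2)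

-- What a node of the given layer would hear in a round of π₀, from what it
-- heard in the three sub-rounds of the corresponding phase of π₁.
reconstruct : ℕ → Heard → Heard → Heard → Heard
reconstruct 1 x y z = merge x z
reconstruct _ x y z = y

reconstruct-silent : ∀ k → reconstruct k nothing nothing nothing ≡ nothing
reconstruct-silent zero          = refl
reconstruct-silent 1             = refl
reconstruct-silent (suc (suc k)) = refl

reconstruct-just : ∀ k x y z → Is-just (reconstruct k x y z) →
                   Is-just x ⊎ Is-just y ⊎ Is-just z
reconstruct-just zero          x y z j = inj₂ (inj₁ j)
reconstruct-just 1             x y z j with merge-just x z j
... | inj₁ jx = inj₁ jx
... | inj₂ jz = inj₂ (inj₂ jz)
reconstruct-just (suc (suc k)) x y z j = inj₂ (inj₁ j)

subround : ℕ → ℕ → ℕ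
subround t i = i + t * 3

subround-phase : ∀ t {i} → i < 3 → subround t i % 3 ≡ i
subround-phase t {i} i<3 = trans ([m+kn]%n≡m%n i t 3) (m<n⇒m%n≡m i<3)

subround-index : ∀ t {i} → i < 3 → subround t i / 3 ≡ t
subround-index t {i} i<3 = begin
  (i + t * 3) / 3    ≡⟨ +-distrib-/-∣ʳ i (n∣m*n t) ⟩
  i / 3 + t * 3 / 3  ≡⟨ cong₂ _+_ (m<n⇒m/n≡0 i<3) (m*n/n≡m t 3) ⟩
  t                  ∎
  where open ≡-Reasoning

subround-<-next : ∀ t {i} → i < 3 → subround t i < suc t * 3
subround-<-next t i<3 = +-monoˡ-< (t * 3) i<3

subround-<-bound : ∀ t {i} r → i < 3 → t < r → subround t i < 3 * r
subround-<-bound t {i} r i<3 t<r =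
  subst (subround t i <_) (*-comm r 3) (≤-trans (subround-<-next t i<3) (*-monoˡ-≤ 3 t<r))

0<3 : 0 < 3
0<3 = s≤s z≤n

1<3 : 1 < 3
1<3 = s≤s (s≤s z≤n)

2<3 : 2 < 3
2<3 = s≤s (s≤s (s≤s z≤n))

module Simulation (π₀ : Protocol) where

  -- π₀'s reception in round t, reconstructed from what was heard in the
  -- sub-rounds of phase t (g k = value heard in round k of π₁), given the
  -- π₀-history h of the first t rounds.
  simRound : (ℓ : ℕ) (nb : ℕ → Bool) → (ℕ → Heard) → (t : ℕ) → History t → Heard
  simRound ℓ nb g t h =
    heardAs (act π₀ t ℓ nb h)
            (reconstruct (inferLayer ℓ nb) (g (subround t 0)) (g (subround t 1)) (g (subround t 2)))

  simHistory : (ℓ : ℕ) (nb : ℕ → Bool) → (ℕ → Heard) → (t : ℕ) → History t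
  simHistory ℓ nb g zero    = []
  simHistory ℓ nb g (suc t) = simRound ℓ nb g t (simHistory ℓ nb g t) ∷ simHistory ℓ nb g t

  simHistory-local : ∀ ℓ nb g g' t → (∀ k → k < t * 3 → g k ≡ g' k) →
                     simHistory ℓ nb g t ≡ simHistory ℓ nb g' t
  simHistory-local ℓ nb g g' zero    g≡g' = refl
  simHistory-local ℓ nb g g' (suc t) g≡g' = cong₂ _∷_ round ih
    where
    ih : simHistory ℓ nb g t ≡ simHistory ℓ nb g' t
    ih = simHistory-local ℓ nb g g' t (λ k k< → g≡g' k (≤-trans k< (m≤n+m (t * 3) 3)))
    same : ∀ {i} → i < 3 → g (subround t i) ≡ g' (subround t i)
    same i<3 = g≡g' _ (subround-<-next t i<3)
    round : simRound ℓ nb g t (simHistory ℓ nb g t) ≡ simRound ℓ nb g' t (simHistory ℓ nb g' t)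
    round rewrite ih | same 0<3 | same 1<3 | same 2<3 = refl

  simHistory-silent : ∀ ℓ nb g → (∀ k → g k ≡ nothing) → ∀ t →
                      All (λ x → x ≡ nothing) (simHistory ℓ nb g t)
  simHistory-silent ℓ nb g g≡φ zero    = []
  simHistory-silent ℓ nb g g≡φ (suc t) = round ∷ simHistory-silent ℓ nb g g≡φ t
    where
    a = act π₀ t ℓ nb (simHistory ℓ nb g t)
    round : simRound ℓ nb g t (simHistory ℓ nb g t) ≡ nothing
    round rewrite g≡φ (subround t 0) | g≡φ (subround t 1) | g≡φ (subround t 2) =
      trans (cong (heardAs a) (reconstruct-silent (inferLayer ℓ nb))) (heardAs-silent a)

  act₁ : ProtocolFn
  act₁ n ℓ nb h =
    transmitIf (n % 3 ≡ᵇ inferLayer ℓ nb)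
               (act π₀ (n / 3) ℓ nb (simHistory ℓ nb (heardIn h) (n / 3)))

  -- π₁ respects the model: an uninformed non-source node reconstructs a
  -- silent history, on which π₀ does not transmit.
  act₁-valid : ∀ n ℓ (nb : ℕ → Bool) (h : History n) → ℓ ≢ 0 →
               All (λ x → x ≡ nothing) h → ¬ IsTransmit (act₁ n ℓ nb h)
  act₁-valid n ℓ nb h ℓ≢0 h≡φ tx =
    valid π₀ (n / 3) ℓ nb _ ℓ≢0 (simHistory-silent ℓ nb (heardIn h) (heardIn-silent h h≡φ) (n / 3))
          (proj₂ (transmitIf-transmits _ _ tx))

  π₁ : Protocol
  π₁ = record { act = act₁ ; valid = act₁-valid }

signal : (N : Network) → V N → (V N → Action) → V N → Maybe (ℕ × ℕ)
signal N v X u = if adj N v u then txOf (X u) (label N u) else nothing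

incoming : (N : Network) → V N → (V N → Action) → List (ℕ × ℕ)
incoming N v X = mapMaybe (signal N v X) (nodes N)

heardAt-incoming : ∀ N π n v (X : V N → Action) → (∀ u → Execution.actionAt N π n u ≡ X u) →
                   Execution.heardAt N π n v ≡ deliver (X v) (incoming N v X)
heardAt-incoming N π n v X act≡X =
  cong₂ deliver (act≡X v)
        (mapMaybe-cong (λ u → cong (λ a → if adj N v u then txOf a (label N u) else nothing) (act≡X u))
                       (nodes N))

mapMaybe-∷ : ∀ {A B : Set} (f : A → Maybe B) x xs →
             mapMaybe f (x ∷ xs) ≡ fromMaybe (f x) ++ mapMaybe f xs
mapMaybe-∷ f x xs with f x
... | just y  = refl
... | nothing = refl

mapMaybe-tabulate-none : ∀ {A B : Set} {n} (g : Fin n → A) (f : A → Maybe B) →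
                         (∀ k → f (g k) ≡ nothing) → mapMaybe f (tabulate g) ≡ []
mapMaybe-tabulate-none {n = zero}  g f none = refl
mapMaybe-tabulate-none {n = suc n} g f none = begin
  mapMaybe f (tabulate g)
    ≡⟨ mapMaybe-∷ f (g fzero) (tabulate (g ∘ fsuc)) ⟩
  fromMaybe (f (g fzero)) ++ mapMaybe f (tabulate (g ∘ fsuc))
    ≡⟨ cong₂ (λ y ys → fromMaybe y ++ ys) (none fzero)
             (mapMaybe-tabulate-none (g ∘ fsuc) f (none ∘ fsuc)) ⟩
  [] ∎
  where open ≡-Reasoning

mapMaybe-tabulate-single : ∀ {A B : Set} {n} (g : Fin n → A) (f : A → Maybe B) (i : Fin n) →
                           (∀ k → k ≢ i → f (g k) ≡ nothing) →
                           mapMaybe f (tabulate g) ≡ fromMaybe (f (g i))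
mapMaybe-tabulate-single {n = suc n} g f fzero others = begin
  mapMaybe f (tabulate g)
    ≡⟨ mapMaybe-∷ f (g fzero) (tabulate (g ∘ fsuc)) ⟩
  fromMaybe (f (g fzero)) ++ mapMaybe f (tabulate (g ∘ fsuc))
    ≡⟨ cong (fromMaybe (f (g fzero)) ++_)
            (mapMaybe-tabulate-none (g ∘ fsuc) f (λ k → others (fsuc k) (λ ()))) ⟩
  fromMaybe (f (g fzero)) ++ []
    ≡⟨ ++-identityʳ _ ⟩
  fromMaybe (f (g fzero)) ∎
  where open ≡-Reasoning
mapMaybe-tabulate-single {n = suc n} g f (fsuc i) others = begin
  mapMaybe f (tabulate g)
    ≡⟨ mapMaybe-∷ f (g fzero) (tabulate (g ∘ fsuc)) ⟩
  fromMaybe (f (g fzero)) ++ mapMaybe f (tabulate (g ∘ fsuc))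
    ≡⟨ cong₂ (λ y ys → fromMaybe y ++ ys) (others fzero (λ ()))
             (mapMaybe-tabulate-single (g ∘ fsuc) f i
                (λ k k≢i → others (fsuc k) (k≢i ∘ suc-injective))) ⟩
  fromMaybe (f (g (fsuc i))) ∎
  where open ≡-Reasoning

mapMaybe-concatMap-none : ∀ {A B C : Set} (f : B → Maybe C) (g : A → List B) →
                          (∀ x → mapMaybe f (g x) ≡ []) → ∀ xs → mapMaybe f (concatMap g xs) ≡ []
mapMaybe-concatMap-none f g none []       = refl
mapMaybe-concatMap-none f g none (x ∷ xs) =
  trans (mapMaybe-++ f (g x) (concatMap g xs))
        (cong₂ _++_ (none x) (mapMaybe-concatMap-none f g none xs))

any-false : ∀ {A : Set} (f : A → Bool) xs → (∀ x → f x ≡ false) → any f xs ≡ false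
any-false f []       never = refl
any-false f (x ∷ xs) never = cong₂ _∨_ (never x) (any-false f xs never)

≢0⇒≡ᵇ0-false : ∀ m → m ≢ 0 → (m ≡ᵇ 0) ≡ false
≢0⇒≡ᵇ0-false zero    m≢0 = ⊥-elim (m≢0 refl)
≢0⇒≡ᵇ0-false (suc m) m≢0 = refl

module C2Network (s : ℕ) (lab : C2Node s → ℕ) (lab-source : lab source ≡ 0)
                 (lab-inj : Injective _≡_ _≡_ lab) (S : Fin s → Fin s → Bool) where

  N : Network
  N = C2net s lab S

  nbr : C2Node s → ℕ → Bool
  nbr v ℓ = any (λ u → c2adj S v u ∧ (lab u ≡ᵇ ℓ)) (c2nodes s)

  lab-nonsource : ∀ u → u ≢ source → (lab u ≡ᵇ 0) ≡ false
  lab-nonsource u u≢src = ≢0⇒≡ᵇ0-false (lab u) (λ e → u≢src (lab-inj (trans e (sym lab-source))))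

  nbr-l1 : ∀ a b → nbr (l1 a b) 0 ≡ true
  nbr-l1 a b rewrite lab-source = refl

  nbr-l2 : ∀ k → nbr (l2 k) 0 ≡ false
  nbr-l2 k = any-false _ (c2nodes s) no-zero
    where
    no-zero : ∀ u → (c2adj S (l2 k) u ∧ (lab u ≡ᵇ 0)) ≡ false
    no-zero source   = refl
    no-zero (l1 a b) = trans (cong ((S a b ∧ does (a ≟ k)) ∧_) (lab-nonsource (l1 a b) λ ())) (∧-zeroʳ _)
    no-zero (l2 _)   = refl

  inferLayer-correct : ∀ u → inferLayer (lab u) (nbr u) ≡ layer u
  inferLayer-correct source   rewrite lab-source = refl
  inferLayer-correct (l1 a b) rewrite lab-nonsource (l1 a b) (λ ()) | nbr-l1 a b = refl
  inferLayer-correct (l2 k)   rewrite lab-nonsource (l2 k) (λ ()) | nbr-l2 k = refl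

  SameOnL₁ : (C2Node s → Action) → (C2Node s → Action) → Set
  SameOnL₁ X Y = ∀ c d → txOf (X (l1 c d)) (lab (l1 c d)) ≡ txOf (Y (l1 c d)) (lab (l1 c d))

  -- Source and L₂ nodes only have L₁ neighbours, so what reaches them
  -- depends only on what the L₁ nodes send.
  signal-nonL1 : ∀ v → layer v ≢ 1 → ∀ X Y → SameOnL₁ X Y → ∀ u → signal N v X u ≡ signal N v Y u
  signal-nonL1 source   _    X Y sameL₁ source   = refl
  signal-nonL1 source   _    X Y sameL₁ (l1 c d) = sameL₁ c d
  signal-nonL1 source   _    X Y sameL₁ (l2 _)   = refl
  signal-nonL1 (l1 _ _) v∉L₁ X Y sameL₁ u        = ⊥-elim (v∉L₁ refl)
  signal-nonL1 (l2 _)   _    X Y sameL₁ source   = refl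
  signal-nonL1 (l2 k)   _    X Y sameL₁ (l1 c d) =
    cong (λ m → if c2adj S (l2 k) (l1 c d) then m else nothing) (sameL₁ c d)
  signal-nonL1 (l2 _)   _    X Y sameL₁ (l2 _)   = refl

  incoming-nonL1 : ∀ v → layer v ≢ 1 → ∀ X Y → SameOnL₁ X Y → incoming N v X ≡ incoming N v Y
  incoming-nonL1 v v∉L₁ X Y sameL₁ = mapMaybe-cong (signal-nonL1 v v∉L₁ X Y sameL₁) (c2nodes s)

  incoming-l1 : ∀ a b X → incoming N (l1 a b) X ≡
                fromMaybe (signal N (l1 a b) X source) ++ fromMaybe (signal N (l1 a b) X (l2 a))
  incoming-l1 a b X = begin
    mapMaybe f (source ∷ (L₁ ++ L₂))                 ≡⟨ mapMaybe-∷ f source (L₁ ++ L₂) ⟩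
    fromMaybe (f source) ++ mapMaybe f (L₁ ++ L₂)    ≡⟨ cong (fromMaybe (f source) ++_) (mapMaybe-++ f L₁ L₂) ⟩
    fromMaybe (f source) ++ (mapMaybe f L₁ ++ mapMaybe f L₂)
      ≡⟨ cong₂ (λ xs ys → fromMaybe (f source) ++ (xs ++ ys)) L₁-silent L₂-only-a ⟩
    fromMaybe (f source) ++ fromMaybe (f (l2 a))     ∎
    where
    open ≡-Reasoning
    f = signal N (l1 a b) X
    L₁ = concatMap (λ i → map (l1 i) (allFin s)) (allFin s)
    L₂ = map l2 (allFin s)
    L₁-silent : mapMaybe f L₁ ≡ []
    L₁-silent = mapMaybe-concatMap-none f _
      (λ i → trans (mapMaybe-map f (l1 i) (allFin s))
                   (mapMaybe-tabulate-none (λ k → k) (f ∘ l1 i) (λ _ → refl)))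
      (allFin s)
    other-group : ∀ k → k ≢ a → f (l2 k) ≡ nothing
    other-group k k≢a rewrite dec-false (a ≟ k) (k≢a ∘ sym) | ∧-zeroʳ (S a b) = refl
    L₂-only-a : mapMaybe f L₂ ≡ fromMaybe (f (l2 a))
    L₂-only-a = trans (mapMaybe-map f l2 (allFin s))
                      (mapMaybe-tabulate-single (λ k → k) (f ∘ l2) a other-group)

  hear-l1 : ∀ a b X → deliver receive (incoming N (l1 a b) X) ≡
            merge (signal N (l1 a b) X source) (signal N (l1 a b) X (l2 a))
  hear-l1 a b X =
    trans (cong (deliver receive) (incoming-l1 a b X))
          (sym (merge-spec (signal N (l1 a b) X source) (signal N (l1 a b) X (l2 a))))

module Correctness (π₀ : Protocol) (s : ℕ) (lab : C2Node s → ℕ) (lab-source : lab source ≡ 0)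
                   (lab-inj : Injective _≡_ _≡_ lab) (S : Fin s → Fin s → Bool) where
  open Simulation π₀
  open C2Network s lab lab-source lab-inj S
  open ≡-Reasoning
  module E₀ = Execution N π₀
  module E₁ = Execution N π₁

  heard₁ : C2Node s → ℕ → Heard
  heard₁ v k = E₁.heardAt k v

  act₀ : ℕ → C2Node s → Action
  act₀ t = E₀.actionAt t

  Faithful : ℕ → Set
  Faithful t = ∀ v → simHistory (lab v) (nbr v) (heard₁ v) t ≡ E₀.hist t v

  phaseActions : ℕ → ℕ → C2Node s → Action
  phaseActions t i u = transmitIf (i ≡ᵇ layer u) (act₀ t u)

  actions₁ : ∀ t → Faithful t → ∀ {i} → i < 3 → ∀ u →
             E₁.actionAt (subround t i) u ≡ phaseActions t i u
  actions₁ t faithful-t {i} i<3 u = begin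
    transmitIf (n % 3 ≡ᵇ inferLayer ℓ nb) (act π₀ (n / 3) ℓ nb (simHistory ℓ nb (heardIn h) (n / 3)))
      ≡⟨ cong₂ (λ m q → transmitIf (m ≡ᵇ inferLayer ℓ nb) (act π₀ q ℓ nb (simHistory ℓ nb (heardIn h) q)))
               (subround-phase t i<3) (subround-index t i<3) ⟩
    transmitIf (i ≡ᵇ inferLayer ℓ nb) (act π₀ t ℓ nb (simHistory ℓ nb (heardIn h) t))
      ≡⟨ cong₂ (λ L H → transmitIf (i ≡ᵇ L) (act π₀ t ℓ nb H)) (inferLayer-correct u) history ⟩
    transmitIf (i ≡ᵇ layer u) (act₀ t u) ∎
    where
    n = subround t i
    ℓ = lab u
    nb = nbr u
    h = E₁.hist n u
    history : simHistory ℓ nb (heardIn h) t ≡ E₀.hist t u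
    history = trans (simHistory-local ℓ nb (heardIn h) (heard₁ u) t
                       (λ k k< → heardIn-hist N π₁ n u k (≤-trans k< (m≤n+m (t * 3) i))))
                    (faithful-t u)

  -- Source and L₂ nodes listen in sub-round 1, when exactly their
  -- neighbours act as in π₀.
  hear-via-L₁ : ∀ t → Faithful t → ∀ w → layer w ≢ 1 →
                heard₁ w (subround t 1) ≡ deliver receive (incoming N w (act₀ t))
  hear-via-L₁ t faithful-t w w∉L₁ =
    trans (heardAt-incoming N π₁ (subround t 1) w (phaseActions t 1) (actions₁ t faithful-t 1<3))
          (cong₂ deliver (listens w w∉L₁)
                 (incoming-nonL1 w w∉L₁ _ _ (λ c d → txOf-listening (act₀ t (l1 c d)) (lab (l1 c d)))))
    where
    listens : ∀ w → layer w ≢ 1 → phaseActions t 1 w ≡ receive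
    listens source   _     = refl
    listens (l1 _ _) w∉L₁ = ⊥-elim (w∉L₁ refl)
    listens (l2 _)   _     = refl

  -- An L₁ node listens in sub-rounds 0 and 2, hearing the source in the
  -- former and its L₂ node in the latter.
  hear-source : ∀ t → Faithful t → ∀ a b →
                heard₁ (l1 a b) (subround t 0) ≡ signal N (l1 a b) (act₀ t) source
  hear-source t faithful-t a b = begin
    heard₁ v (subround t 0)
      ≡⟨ heardAt-incoming N π₁ (subround t 0) v (phaseActions t 0) (actions₁ t faithful-t 0<3) ⟩
    deliver receive (incoming N v (phaseActions t 0))
      ≡⟨ hear-l1 a b (phaseActions t 0) ⟩
    merge (signal N v (phaseActions t 0) source) (signal N v (phaseActions t 0) (l2 a))
      ≡⟨ cong₂ merge (txOf-listening (act₀ t source) (lab source)) (if-eta (c2adj S v (l2 a))) ⟩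
    merge (signal N v (act₀ t) source) nothing
      ≡⟨ merge-identityʳ _ ⟩
    signal N v (act₀ t) source ∎
    where
    v = l1 a b

  hear-group : ∀ t → Faithful t → ∀ a b →
               heard₁ (l1 a b) (subround t 2) ≡ signal N (l1 a b) (act₀ t) (l2 a)
  hear-group t faithful-t a b = begin
    heard₁ v (subround t 2)
      ≡⟨ heardAt-incoming N π₁ (subround t 2) v (phaseActions t 2) (actions₁ t faithful-t 2<3) ⟩
    deliver receive (incoming N v (phaseActions t 2))
      ≡⟨ hear-l1 a b (phaseActions t 2) ⟩
    signal N v (phaseActions t 2) (l2 a)
      ≡⟨ cong (λ m → if c2adj S v (l2 a) then m else nothing)
              (txOf-listening (act₀ t (l2 a)) (lab (l2 a))) ⟩
    signal N v (act₀ t) (l2 a) ∎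
    where
    v = l1 a b

  reconstruct-correct : ∀ t → Faithful t → ∀ v →
    reconstruct (layer v) (heard₁ v (subround t 0)) (heard₁ v (subround t 1)) (heard₁ v (subround t 2))
    ≡ deliver receive (incoming N v (act₀ t))
  reconstruct-correct t faithful-t source   = hear-via-L₁ t faithful-t source (λ ())
  reconstruct-correct t faithful-t (l2 k)   = hear-via-L₁ t faithful-t (l2 k) (λ ())
  reconstruct-correct t faithful-t (l1 a b) =
    trans (cong₂ merge (hear-source t faithful-t a b) (hear-group t faithful-t a b))
          (sym (hear-l1 a b (act₀ t)))

  phase-correct : ∀ t → Faithful t → ∀ v →
                  simRound (lab v) (nbr v) (heard₁ v) t (E₀.hist t v) ≡ E₀.heardAt t v
  phase-correct t faithful-t v = begin
    heardAs a (reconstruct (inferLayer (lab v) (nbr v)) (g 0) (g 1) (g 2))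
      ≡⟨ cong (λ L → heardAs a (reconstruct L (g 0) (g 1) (g 2))) (inferLayer-correct v) ⟩
    heardAs a (reconstruct (layer v) (g 0) (g 1) (g 2))
      ≡⟨ cong (heardAs a) (reconstruct-correct t faithful-t v) ⟩
    heardAs a (deliver receive (incoming N v (act₀ t)))
      ≡⟨ sym (deliver-heardAs a _) ⟩
    E₀.heardAt t v ∎
    where
    a = act₀ t v
    g : ℕ → Heard
    g i = heard₁ v (subround t i)

  faithful : ∀ t → Faithful t
  faithful zero    v = refl
  faithful (suc t) v =
    cong₂ _∷_ (trans (cong (simRound (lab v) (nbr v) (heard₁ v) t) (faithful t v))
                     (phase-correct t (faithful t) v))
              (faithful t v)

  completes : ∀ r → Completes N π₀ r → Completes N π₁ (3 * r)
  completes r completes₀ v v≢src with completes₀ v v≢src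
  ... | t , t<r , informed with reconstruct-just (inferLayer (lab v) (nbr v)) _ _ _
        (heardAs-just (act₀ t v) _ (subst Is-just (sym (phase-correct t (faithful t) v)) informed))
  ...   | inj₁ j        = subround t 0 , subround-<-bound t r 0<3 t<r , j
  ...   | inj₂ (inj₁ j) = subround t 1 , subround-<-bound t r 1<3 t<r , j
  ...   | inj₂ (inj₂ j) = subround t 2 , subround-<-bound t r 2<3 t<r , j

  layered : ∀ n v → IsTransmit (E₁.actionAt n v) → n % 3 ≡ layer v
  layered n v tx = trans (≡ᵇ⇒≡ _ _ (proj₁ (transmitIf-transmits _ _ tx))) (inferLayer-correct v)

lemma3 : (s : ℕ) (lab : C2Node s → ℕ) → lab source ≡ 0 → Injective _≡_ _≡_ lab →
         (r : ℕ) →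
         Σ Protocol (λ π₀ → ∀ (S : Fin s → Fin s → Bool) → C2Connected S →
                              Completes (C2net s lab S) π₀ r) →
         Σ Protocol (λ π₁ → ∀ (S : Fin s → Fin s → Bool) → C2Connected S →
                              Completes (C2net s lab S) π₁ (3 * r)
                              × (∀ (t : ℕ) (v : C2Node s) →
                                   IsTransmit (Execution.actionAt (C2net s lab S) π₁ t v) →
                                   t % 3 ≡ layer v))
lemma3 s lab lab-source lab-inj r (π₀ , completes₀) =
  Simulation.π₁ π₀ ,
  λ S connected → let open Correctness π₀ s lab lab-source lab-inj S in
                  completes r (completes₀ S connected) , layered
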